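{- Let $D=\langle d_1,\ldots,d_n\rangle$ be an instance of $2$-Visits. If a feasible schedule places some secondary visit at a position $p$ that is not a gap, then there exists a primary visit at some position $q<p$ belonging to a node $u$ with $d_u\ge p$.
   Context: $2$-Visits: given a non-decreasing sequence of positive integers $d_1,\ldots,d_n$, a feasible schedule is a sequence of length $2n$ (positions $1,\ldots,2n$) containing, for each node $i$, one primary and one secondary visit, such that the primary visit of $i$ is at a position $t_i\le d_i$ and the secondary visit of $i$ is either before its primary visit or at a position at most $t_i+d_i$. The discretized sequence $A$ is defined by $a_n=d_n$ and $a_i=\min\{a_{i+1}-1,d_i\}$ for $i<n$; a position $j\in\{1,\ldots,2n\}$ is a gap if $j\notin\{a_1,\ldots,a_n\}$. -}

module Defs where

open import Data.Nat using (ℕ; zero; suc; _+_; _*_; _∸_; _≤_; _<_; _⊓_)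
open import Data.Fin using (Fin; toℕ)
import Data.Fin as F
open import Relation.Nullary using (¬_)
open import Data.Vec using (Vec; []; _∷_; lookup; head)
open import Data.Product using (_×_; _,_; ∃)
open import Data.Sum using (_⊎_)
open import Function.Definitions using (Bijective)
open import Relation.Binary.PropositionalEquality using (_≡_)

record Instance (n : ℕ) (d : Vec ℕ n) : Set where
  field
    positive    : ∀ (i : Fin n) → 1 ≤ lookup d i
    nondecreasing : ∀ (i j : Fin n) → i F.≤ j → lookup d i ≤ lookup d j

data Kind : Set where
  primary secondary : Kind

Visit : ℕ → Set
Visit n = Fin n × Kind

-- A schedule of length 2n: slot j (0-indexed) is at position toℕ j + 1.
-- It contains every visit exactly once (bijective).
Schedule : ℕ → Set
Schedule n = Fin (2 * n) → Visit n

pos : ∀ {m} → Fin m → ℕ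
pos j = suc (toℕ j)

record Feasible {n : ℕ} (d : Vec ℕ n) (s : Schedule n) : Set where
  field
    bijective : Bijective _≡_ _≡_ s
    primaryDeadline : ∀ (j : Fin (2 * n)) (i : Fin n) →
      s j ≡ (i , primary) → pos j ≤ lookup d i
    secondaryOK : ∀ (j k : Fin (2 * n)) (i : Fin n) →
      s j ≡ (i , primary) → s k ≡ (i , secondary) →
      pos k < pos j ⊎ pos k ≤ pos j + lookup d i

-- Discretized sequence: aₙ = dₙ, aᵢ = min(aᵢ₊₁ − 1, dᵢ).
-- (Computed in ℕ with truncated subtraction; values that would be ≤ 0
-- become 0, which does not affect membership of positions 1..2n.)
disc : ∀ {n} → Vec ℕ n → Vec ℕ n
disc [] = []
disc (x ∷ []) = x ∷ []
disc (x ∷ y ∷ xs) = ((head (disc (y ∷ xs)) ∸ 1) ⊓ x) ∷ disc (y ∷ xs)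

IsGap : ∀ {n} → Vec ℕ n → ℕ → Set
IsGap {n} d p = (1 ≤ p × p ≤ 2 * n) × (∀ (i : Fin n) → ¬ (lookup (disc d) i ≡ p))

-- If p = aᵢ is not a gap, follow aⱼ = aⱼ₊₁ − 1 < dⱼ from j = i until
-- aⱼ = dⱼ or j = n: this exposes m + 1 distinct nodes i, …, i + m, all
-- with deadline in [p, p + m].  Their primary visits lie at positions
-- ≤ p + m.  Were every one of them at a position > p (none can be at p,
-- which holds a secondary visit), m + 1 distinct positions would fit into
-- the m positions p + 1, …, p + m.  So one of them lies before p, and its
-- node has deadline ≥ p.
module Submission where

open import Defs
open import Data.Nat using (ℕ; suc; _*_; _+_; _∸_; pred; _≤_; _<_; z≤n; s≤s; s≤s⁻¹; _≤?_; _<?_; _≟_)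
open import Data.Nat.Properties
  using (≤-trans; ≤-reflexive; <⇒≤; ≰⇒>; ≮⇒≥; ≤∧≢⇒<; n≤1+n; 1+n≰n; +-suc; +-identityʳ;
         m≤n⇒m⊓n≡m; m≥n⇒m⊓n≡n; ∸-monoˡ-<; ∸-cancelʳ-≡; m+n∸m≡n)
open import Data.Fin using (Fin; toℕ; fromℕ<)
import Data.Fin as F
open import Data.Fin.Properties using (any?; injective⇒≤; toℕ<n; toℕ-injective; toℕ-fromℕ<; suc-injective)
open import Data.Vec using (Vec; []; _∷_; lookup; head)
open import Data.Product using (_×_; _,_; ∃; proj₁; proj₂)
open import Data.Empty using (⊥-elim)
open import Relation.Nullary using (¬_; yes; no)
open import Relation.Binary.PropositionalEquality using (_≡_; _≢_; refl; sym; trans; cong; subst; module ≡-Reasoning)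
open import Function.Definitions using (Injective)

Nondecreasing : ∀ {n} → Vec ℕ n → Set
Nondecreasing {n} d = ∀ (i j : Fin n) → i F.≤ j → lookup d i ≤ lookup d j

Nondecreasing-tail : ∀ {n x} {xs : Vec ℕ n} → Nondecreasing (x ∷ xs) → Nondecreasing xs
Nondecreasing-tail mono i j i≤j = mono (F.suc i) (F.suc j) (s≤s i≤j)

interval-pigeonhole : ∀ {a} (p m : ℕ) (f : Fin a → ℕ) → Injective _≡_ _≡_ f →
  (∀ t → p ≤ f t × f t < p + m) → a ≤ m
interval-pigeonhole {a} p m f f-inj f-in = injective⇒≤ offset-injective
  where
  offset-bound : ∀ t → f t ∸ p < m
  offset-bound t = subst (f t ∸ p <_) (m+n∸m≡n p m) (∸-monoˡ-< (proj₂ (f-in t)) (proj₁ (f-in t)))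

  offset : Fin a → Fin m
  offset t = fromℕ< (offset-bound t)

  offset-injective : Injective _≡_ _≡_ offset
  offset-injective {t} {u} eq = f-inj (∸-cancelʳ-≡ (proj₁ (f-in t)) (proj₁ (f-in u)) (begin
    f t ∸ p              ≡⟨ sym (toℕ-fromℕ< (offset-bound t)) ⟩
    toℕ (offset t)       ≡⟨ cong toℕ eq ⟩
    toℕ (offset u)       ≡⟨ toℕ-fromℕ< (offset-bound u) ⟩
    f u ∸ p              ∎))
    where open ≡-Reasoning

record Crowd {n} (d : Vec ℕ n) (p : ℕ) : Set where
  field
    extent           : ℕ
    member           : Fin (suc extent) → Fin n
    member-injective : Injective _≡_ _≡_ member
    member-deadline  : ∀ t → p ≤ lookup d (member t) × lookup d (member t) ≤ p + extent

singleton-crowd : ∀ {n} (d : Vec ℕ (suc n)) {p} → lookup d F.zero ≡ p → Crowd d p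
singleton-crowd d {p} eq = record
  { extent           = 0
  ; member           = λ _ → F.zero
  ; member-injective = λ { {F.zero} {F.zero} _ → refl }
  ; member-deadline  = λ _ → ≤-reflexive (sym eq) , ≤-reflexive (trans eq (sym (+-identityʳ p)))
  }

crowd-weaken : ∀ {n x} {xs : Vec ℕ n} {p} → Crowd xs p → Crowd (x ∷ xs) p
crowd-weaken c = record
  { extent           = extent
  ; member           = λ t → F.suc (member t)
  ; member-injective = λ eq → member-injective (suc-injective eq)
  ; member-deadline  = member-deadline
  }
  where open Crowd c

crowd-extend : ∀ {n x} {xs : Vec ℕ (suc n)} {p} → Nondecreasing (x ∷ xs) → p < x →
  Crowd xs (suc p) → Crowd (x ∷ xs) p
crowd-extend {x = x} {xs} {p} mono p<x c = record
  { extent           = suc extent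
  ; member           = member′
  ; member-injective = member′-injective
  ; member-deadline  = member′-deadline
  }
  where
  open Crowd c

  member′ : Fin (suc (suc extent)) → Fin (suc _)
  member′ F.zero    = F.zero
  member′ (F.suc t) = F.suc (member t)

  member′-injective : Injective _≡_ _≡_ member′
  member′-injective {F.zero}  {F.zero}  _  = refl
  member′-injective {F.suc t} {F.suc u} eq = cong F.suc (member-injective (suc-injective eq))

  below-top : ∀ t → lookup xs (member t) ≤ p + suc extent
  below-top t = ≤-trans (proj₂ (member-deadline t)) (≤-reflexive (sym (+-suc p extent)))

  member′-deadline : ∀ t → p ≤ lookup (x ∷ xs) (member′ t) × lookup (x ∷ xs) (member′ t) ≤ p + suc extent
  member′-deadline F.zero    = <⇒≤ p<x , ≤-trans (mono F.zero (F.suc (member F.zero)) z≤n) (below-top F.zero)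
  member′-deadline (F.suc t) = ≤-trans (n≤1+n p) (proj₁ (member-deadline t)) , below-top t

disc-head-crowd : ∀ {n x y} {xs : Vec ℕ n} → Nondecreasing (x ∷ y ∷ xs) →
  (∀ q → lookup (disc (y ∷ xs)) F.zero ≡ suc q → Crowd (y ∷ xs) (suc q)) →
  ∀ p → lookup (disc (x ∷ y ∷ xs)) F.zero ≡ suc p → Crowd (x ∷ y ∷ xs) (suc p)
disc-head-crowd {x = x} {y} {xs} mono tail-crowd p eq with x ≤? head (disc (y ∷ xs)) ∸ 1
... | yes x≤ = singleton-crowd (x ∷ y ∷ xs) (trans (sym (m≥n⇒m⊓n≡n x≤)) eq)
... | no x≰ = crowd-extend mono (subst (_< x) next≡ (≰⇒> x≰)) (tail-crowd (suc p) (head≡ (disc (y ∷ xs)) next≡))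
  where
  next≡ : head (disc (y ∷ xs)) ∸ 1 ≡ suc p
  next≡ = trans (sym (m≤n⇒m⊓n≡m (<⇒≤ (≰⇒> x≰)))) eq

  head≡ : ∀ {k} (v : Vec ℕ (suc k)) → head v ∸ 1 ≡ suc p → lookup v F.zero ≡ suc (suc p)
  head≡ (suc h ∷ _) eq′ = cong suc eq′

-- Stated for aᵢ = suc p: with truncated subtraction, aᵢ = 0 need not come from a crowd.
disc-crowd : ∀ {n} (d : Vec ℕ n) → Nondecreasing d → ∀ i p →
  lookup (disc d) i ≡ suc p → Crowd d (suc p)
disc-crowd (x ∷ [])     mono F.zero    p eq = singleton-crowd (x ∷ []) eq
disc-crowd (x ∷ y ∷ xs) mono (F.suc i) p eq = crowd-weaken (disc-crowd (y ∷ xs) (Nondecreasing-tail mono) i p eq)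
disc-crowd (x ∷ y ∷ xs) mono F.zero    p eq =
  disc-head-crowd mono (disc-crowd (y ∷ xs) (Nondecreasing-tail mono) F.zero) p eq

nonGap-disc : ∀ {n} (d : Vec ℕ n) (k : Fin (2 * n)) → ¬ IsGap d (pos k) →
  ∃ λ i → lookup (disc d) i ≡ pos k
nonGap-disc d k nonGap with any? (λ i → lookup (disc d) i ≟ pos k)
... | yes found = found
... | no none   = ⊥-elim (nonGap ((s≤s z≤n , toℕ<n k) , λ i eq → none (i , eq)))

module _ {n} {d : Vec ℕ n} {s : Schedule n} (feasible : Feasible d s) where
  open Feasible feasible

  primarySlot : Fin n → Fin (2 * n)
  primarySlot i = proj₁ (proj₂ bijective (i , primary))

  primarySlot-visit : ∀ i → s (primarySlot i) ≡ (i , primary)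
  primarySlot-visit i = proj₂ (proj₂ bijective (i , primary)) refl

  primarySlot-injective : Injective _≡_ _≡_ primarySlot
  primarySlot-injective {i} {j} eq =
    cong proj₁ (trans (sym (primarySlot-visit i)) (trans (cong s eq) (primarySlot-visit j)))

  primarySlot-deadline : ∀ i → pos (primarySlot i) ≤ lookup d i
  primarySlot-deadline i = primaryDeadline (primarySlot i) i (primarySlot-visit i)

  crowd-early-primary : ∀ (k : Fin (2 * n)) v → s k ≡ (v , secondary) → (c : Crowd d (pos k)) →
    ∃ λ t → pos (primarySlot (Crowd.member c t)) < pos k
  crowd-early-primary k v sk c with any? (λ t → pos (primarySlot (Crowd.member c t)) <? pos k)
  ... | yes early = early
  ... | no none   = ⊥-elim (1+n≰n (interval-pigeonhole (pos k) extent slot slot-injective slot-in))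
    where
    open Crowd c

    slot : Fin (suc extent) → ℕ
    slot t = toℕ (primarySlot (member t))

    slot-injective : Injective _≡_ _≡_ slot
    slot-injective eq = member-injective (primarySlot-injective (toℕ-injective eq))

    slot≢k : ∀ t → pos k ≢ pos (primarySlot (member t))
    slot≢k t eq with trans (sym sk) (trans (cong s (toℕ-injective (cong pred eq))) (primarySlot-visit (member t)))
    ... | ()

    slot-in : ∀ t → pos k ≤ slot t × slot t < pos k + extent
    slot-in t = s≤s⁻¹ (≤∧≢⇒< (≮⇒≥ (λ early → none (t , early))) (slot≢k t))
              , ≤-trans (primarySlot-deadline (member t)) (proj₂ (member-deadline t))

lemma4 : ∀ (n : ℕ) (d : Vec ℕ n) → Instance n d →
    ∀ (s : Schedule n) → Feasible d s →
    ∀ (k : Fin (2 * n)) (v : Fin n) → s k ≡ (v , secondary) →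
    ¬ IsGap d (pos k) →
    ∃ λ (j : Fin (2 * n)) → ∃ λ (u : Fin n) →
      pos j < pos k × s j ≡ (u , primary) × pos k ≤ lookup d u
lemma4 n d inst s feasible k v sk nonGap
  with i , aᵢ≡p ← nonGap-disc d k nonGap
  with crowd ← disc-crowd d (Instance.nondecreasing inst) i (toℕ k) aᵢ≡p
  with t , early ← crowd-early-primary feasible k v sk crowd
  = primarySlot feasible u , u , early , primarySlot-visit feasible u , proj₁ (Crowd.member-deadline crowd t)
  where
  u : Fin n
  u = Crowd.member crowd t
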